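{- $\textsc{Empty-Child}\le_{dt}\textsc{Nephew}$.
   Context: Query model: inputs consist of functions between finite sets, accessed by querying bits of the binary encodings of their values. $R\le_{dt}S$ means each instance of $R$ (size parameter $N$) reduces to an instance of $S$ whose input bits are computed by decision trees over the $R$-input and whose solutions are mapped back to solutions of $R$ by decision trees, with log of the $S$-input length plus maximum decision-tree depth at most $\mathrm{polylog}(N)$. $\textsc{Empty-Child}$: given $V=[N]$ and $F,L,R:V\to V$, a solution is (s1) $u\in V$ with $F(L(u))\neq u$ or $F(R(u))\neq u$ or $L(u)=R(u)\neq u$, or (s2) the vertex $1$ if $L(1)=1$ or $R(1)=1$ or $F(1)\neq1$. $\textsc{Nephew}$: given a finite set $V$ and $f,g:V\to V$, a solution is any $u\in V$ with $f(f(g(u)))\neq f(u)$ or $f(g(u))=u$. -}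

module Defs where

open import Data.Nat using (ℕ; zero; suc; _+_; _*_; _^_; _≤_; ⌊_/2⌋; _⊔_)
open import Data.Nat.Logarithm using (⌈log₂_⌉)
open import Data.Bool using (Bool; true; false; if_then_else_; not)
open import Data.Fin using (Fin; toℕ)
import Data.Fin as Fin
open import Data.Product using (Σ; ∃; _×_; _,_)
open import Data.Sum using (_⊎_)
open import Relation.Binary.PropositionalEquality using (_≡_; _≢_)

testBit : ℕ → ℕ → Bool
testBit n zero    = isOdd n
  where
  isOdd : ℕ → Bool
  isOdd zero    = false
  isOdd (suc k) = not (isOdd k)
testBit n (suc j) = testBit ⌊ n /2⌋ j

bitLen : ℕ → ℕ
bitLen N = ⌈log₂ N ⌉

data DT (Q : Set) (A : Set) : Set where
  leaf : A → DT Q A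
  node : Q → DT Q A → DT Q A → DT Q A

eval : {Q A : Set} → DT Q A → (Q → Bool) → A
eval (leaf a)       x = a
eval (node q t₀ t₁) x = if x q then eval t₁ x else eval t₀ x

depth : {Q A : Set} → DT Q A → ℕ
depth (leaf _)       = 0
depth (node _ t₀ t₁) = suc (depth t₀ ⊔ depth t₁)

-- EMPTY-CHILD.  V = [N] is represented by Fin N (vertex i+1 ↦ i, so
-- the distinguished vertex 1 is Fin.zero); N = suc n ≥ 1.

record ECInput (n : ℕ) : Set where
  constructor ecInput
  field
    F L R : Fin (suc n) → Fin (suc n)

ECQuery : ℕ → Set
ECQuery n = Fin 3 × Fin (suc n) × Fin (bitLen (suc n))

ecBits : {n : ℕ} → ECInput n → ECQuery n → Bool
ecBits I (Fin.zero , v , j)              = testBit (toℕ (ECInput.F I v)) (toℕ j)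
ecBits I (Fin.suc Fin.zero , v , j)      = testBit (toℕ (ECInput.L I v)) (toℕ j)
ecBits I (Fin.suc (Fin.suc _) , v , j)   = testBit (toℕ (ECInput.R I v)) (toℕ j)

ECSol : {n : ℕ} → ECInput n → Fin (suc n) → Set
ECSol {n} I u =
  (F (L u) ≢ u ⊎ F (R u) ≢ u ⊎ (L u ≡ R u × R u ≢ u))
  ⊎ (u ≡ Fin.zero × (L Fin.zero ≡ Fin.zero ⊎ R Fin.zero ≡ Fin.zero ⊎ F Fin.zero ≢ Fin.zero))
  where open ECInput I

NephewSol : {M : ℕ} → (f g : Fin M → Fin M) → Fin M → Set
NephewSol f g u = f (f (g u)) ≢ f u ⊎ f (g u) ≡ u

record DTReduction (n : ℕ) (D : ℕ) (m : ℕ) : Set where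
  field
    fTree gTree : Fin (suc m) → DT (ECQuery n) (Fin (suc m))
    solTree     : Fin (suc m) → DT (ECQuery n) (Fin (suc n))
    fDepth      : ∀ v → depth (fTree v) ≤ D
    gDepth      : ∀ v → depth (gTree v) ≤ D
    solDepth    : ∀ v → depth (solTree v) ≤ D
    correct     : ∀ (I : ECInput n) (w : Fin (suc m)) →
                  NephewSol (λ v → eval (fTree v) (ecBits I))
                            (λ v → eval (gTree v) (ecBits I)) w →
                  ECSol I (eval (solTree w) (ecBits I))

EmptyChild≤dtNephew : Set
EmptyChild≤dtNephew =
  Σ ℕ λ c → Σ ℕ λ k → ∀ (n : ℕ) →
    Σ ℕ λ m → Σ ℕ λ D →
      (bitLen (suc m) + D ≤ c * (suc (bitLen (suc n))) ^ k) × DTReduction n D m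

-- The Nephew instance lives on V itself: f is the parent map F and g u = L s for the sibling s
-- of u (the child of F u other than u), so g u is a nephew of u and f (f (g u)) = F u = f u.
-- Isolated vertices (fixed by F, L and R) are not EMPTY-CHILD solutions, so they must not create
-- Nephew solutions: f sends their children to the root 1, and g sends them to L (L 1), a
-- grandchild of the root.  If none of 1, L 1, F w and the sibling of w is an EMPTY-CHILD solution,
-- these vertices satisfy the local tree constraints, which force f (f (g w)) = f w and f (g w) ≠ w;
-- so w is mapped back to the first of them that is a solution.  Every map reads O(1) values of
-- F, L, R, that is O(log N) input bits.

module Submission where

open import Defs
open import Data.Nat using (ℕ; zero; suc; _+_; _*_; _^_; _≤_; _<_; ⌊_/2⌋; ⌈_/2⌉; z≤n; s≤s; _<?_)
open import Data.Nat.Properties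
open import Data.Nat.Logarithm.Core using (⌈log2⌉)
open import Data.Nat.Induction using (<-wellFounded)
open import Induction.WellFounded using (Acc; acc)
open import Data.Bool using (Bool; true; false; if_then_else_)
open import Data.Bool.Properties using (not-involutive)
open import Data.Fin using (Fin; toℕ; fromℕ<) renaming (zero to fzero; suc to fsuc)
open import Data.Fin.Properties using (toℕ<n; fromℕ<-toℕ) renaming (_≟_ to _≟ᶠ_)
open import Data.Product using (_×_; _,_; proj₁)
open import Data.Sum using (_⊎_; inj₁; inj₂)
import Data.Sum as Sum
open import Data.Empty using (⊥; ⊥-elim)
open import Function using (_∘_; id)
open import Relation.Nullary using (Dec; yes; no; ¬_; does)
open import Relation.Nullary.Decidable using (_×-dec_; _⊎-dec_; ¬?; dec-true; dec-false; decidable-stable)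
open import Relation.Binary.PropositionalEquality

pushBit : Bool → ℕ → ℕ
pushBit false r = r * 2
pushBit true  r = suc (r * 2)

pushBit-suc : ∀ b r → pushBit b (suc r) ≡ suc (suc (pushBit b r))
pushBit-suc false r = refl
pushBit-suc true  r = refl

testBit-suc-suc : ∀ x → testBit (suc (suc x)) 0 ≡ testBit x 0
testBit-suc-suc x = not-involutive (testBit x 0)

pushBit-testBit : ∀ x → pushBit (testBit x 0) ⌊ x /2⌋ ≡ x
pushBit-testBit zero          = refl
pushBit-testBit (suc zero)    = refl
pushBit-testBit (suc (suc x)) rewrite testBit-suc-suc x =
  trans (pushBit-suc (testBit x 0) ⌊ x /2⌋) (cong (suc ∘ suc) (pushBit-testBit x))

*2≤pushBit : ∀ b r → r * 2 ≤ pushBit b r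
*2≤pushBit false r = ≤-refl
*2≤pushBit true  r = n≤1+n (r * 2)

⌊n/2⌋<2^j : ∀ x j → x < 2 ^ suc j → ⌊ x /2⌋ < 2 ^ j
⌊n/2⌋<2^j x j x<2^1+j = *-cancelʳ-< 2 ⌊ x /2⌋ (2 ^ j) (begin-strict
  ⌊ x /2⌋ * 2                   ≤⟨ *2≤pushBit (testBit x 0) ⌊ x /2⌋ ⟩
  pushBit (testBit x 0) ⌊ x /2⌋ ≡⟨ pushBit-testBit x ⟩
  x                             <⟨ x<2^1+j ⟩
  2 * 2 ^ j                     ≡⟨ *-comm 2 (2 ^ j) ⟩
  2 ^ j * 2                     ∎)
  where open ≤-Reasoning

n≤2^⌈log2⌉n : ∀ n (rec : Acc _<_ n) → n ≤ 2 ^ ⌈log2⌉ n rec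
n≤2^⌈log2⌉n 0             _        = z≤n
n≤2^⌈log2⌉n 1             _        = s≤s z≤n
n≤2^⌈log2⌉n (suc (suc m)) (acc rs) = begin
  2 + m                    ≡⟨ cong (2 +_) (sym (⌊n/2⌋+⌈n/2⌉≡n m)) ⟩
  2 + (⌊ m /2⌋ + c)        ≤⟨ +-monoʳ-≤ 2 (+-monoˡ-≤ c (⌊n/2⌋≤⌈n/2⌉ m)) ⟩
  2 + (c + c)              ≡⟨ cong suc (sym (+-suc c c)) ⟩
  suc c + suc c            ≤⟨ +-mono-≤ IH IH ⟩
  2 ^ k + 2 ^ k            ≡⟨ cong (2 ^ k +_) (sym (+-identityʳ (2 ^ k))) ⟩
  2 ^ suc k                ∎
  where
  open ≤-Reasoning
  c k : ℕ
  c = ⌈ m /2⌉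
  k = ⌈log2⌉ (suc c) (rs (⌈n/2⌉<n m))
  IH : suc c ≤ 2 ^ k
  IH = n≤2^⌈log2⌉n (suc c) (rs (⌈n/2⌉<n m))

if-does-elim : {P A : Set} (Q : A → Set) {x y : A} (d : Dec P) →
               (P → Q x) → (¬ P → Q y) → Q (if does d then x else y)
if-does-elim Q (yes p) onYes onNo = onYes p
if-does-elim Q (no ¬p) onYes onNo = onNo ¬p

if-does-yes : {P A : Set} {x y : A} (d : Dec P) → P → (if does d then x else y) ≡ x
if-does-yes d p rewrite dec-true d p = refl

if-does-no : {P A : Set} {x y : A} (d : Dec P) → ¬ P → (if does d then x else y) ≡ y
if-does-no d ¬p rewrite dec-false d ¬p = refl

eval-node : {B A : Set} (q : B) (t : Bool → DT B A) (β : B → Bool) →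
            eval (node q (t false) (t true)) β ≡ eval (t (β q)) β
eval-node q t β with β q
... | false = refl
... | true  = refl

readBits : {B A : Set} (j : ℕ) → (Fin j → B) → (ℕ → DT B A) → DT B A
readBits zero    bit K = K 0
readBits (suc j) bit K = node (bit fzero) (readBits j (bit ∘ fsuc) (K ∘ pushBit false))
                                          (readBits j (bit ∘ fsuc) (K ∘ pushBit true))

eval-readBits : {B A : Set} (j : ℕ) (bit : Fin j → B) (K : ℕ → DT B A) (β : B → Bool) (x : ℕ) →
                x < 2 ^ j → (∀ i → β (bit i) ≡ testBit x (toℕ i)) →
                eval (readBits j bit K) β ≡ eval (K x) β
eval-readBits zero    bit K β zero    _           _     = refl
eval-readBits zero    bit K β (suc x) (s≤s ())    _
eval-readBits {B} {A} (suc j) bit K β x x<2^1+j bits≡ = begin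
  eval (readBits (suc j) bit K) β              ≡⟨ eval-node (bit fzero) rest β ⟩
  eval (rest (β (bit fzero))) β                ≡⟨ cong (λ b → eval (rest b) β) (bits≡ fzero) ⟩
  eval (rest (testBit x 0)) β                  ≡⟨ eval-readBits j (bit ∘ fsuc) _ β ⌊ x /2⌋
                                                    (⌊n/2⌋<2^j x j x<2^1+j) (bits≡ ∘ fsuc) ⟩
  eval (K (pushBit (testBit x 0) ⌊ x /2⌋)) β ≡⟨ cong (λ y → eval (K y) β) (pushBit-testBit x) ⟩
  eval (K x) β                                 ∎
  where
  open ≡-Reasoning
  rest : Bool → DT B A
  rest b = readBits j (bit ∘ fsuc) (K ∘ pushBit b)

depth-readBits : {B A : Set} (j : ℕ) (bit : Fin j → B) (K : ℕ → DT B A) (d : ℕ) →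
                 (∀ r → depth (K r) ≤ d) → depth (readBits j bit K) ≤ j + d
depth-readBits zero    bit K d depth-K = depth-K 0
depth-readBits (suc j) bit K d depth-K =
  s≤s (⊔-lub (depth-readBits j _ _ d (λ _ → depth-K _)) (depth-readBits j _ _ d (λ _ → depth-K _)))

-- Since return is allowed at every index, k in Query A k bounds the number of questions asked.
module Queries (Q : Set) (m : ℕ) where

  data Query (A : Set) : ℕ → Set where
    return : ∀ {k} → A → Query A k
    ask    : ∀ {k} → Q → (Fin (suc m) → Query A k) → Query A (suc k)

  run : ∀ {A k} → Query A k → (Q → Fin (suc m)) → A
  run (return a)   answer = a
  run (ask q next) answer = run (next (answer q)) answer

  width : ℕ
  width = bitLen (suc m)

  toℕ<2^width : (x : Fin (suc m)) → toℕ x < 2 ^ width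
  toℕ<2^width x = <-≤-trans (toℕ<n x) (n≤2^⌈log2⌉n (suc m) (<-wellFounded (suc m)))

  -- Out-of-range bit patterns never arise from genuine answers; they are sent to zero.
  toFin : ℕ → Fin (suc m)
  toFin r with r <? suc m
  ... | yes r<1+m = fromℕ< r<1+m
  ... | no  _     = fzero

  toFin-toℕ : (x : Fin (suc m)) → toFin (toℕ x) ≡ x
  toFin-toℕ x with toℕ x <? suc m
  ... | yes x<1+m = fromℕ<-toℕ x x<1+m
  ... | no  x≮1+m = ⊥-elim (x≮1+m (toℕ<n x))

  compile : ∀ {B A k} → (Q → Fin width → B) → Query A k → DT B A
  compile bit (return a)   = leaf a
  compile bit (ask q next) = readBits width (bit q) (compile bit ∘ next ∘ toFin)

  eval-compile : ∀ {B A k} (bit : Q → Fin width → B) (answer : Q → Fin (suc m)) (β : B → Bool) →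
                 (∀ q i → β (bit q i) ≡ testBit (toℕ (answer q)) (toℕ i)) →
                 (p : Query A k) → eval (compile bit p) β ≡ run p answer
  eval-compile bit answer β bits≡ (return a)   = refl
  eval-compile bit answer β bits≡ (ask q next) = begin
    eval (compile bit (ask q next)) β                ≡⟨ eval-readBits width (bit q) _ β (toℕ a)
                                                          (toℕ<2^width a) (bits≡ q) ⟩
    eval (compile bit (next (toFin (toℕ a)))) β      ≡⟨ cong (λ v → eval (compile bit (next v)) β)
                                                          (toFin-toℕ a) ⟩
    eval (compile bit (next a)) β                    ≡⟨ eval-compile bit answer β bits≡ (next a) ⟩
    run (next a) answer                              ∎
    where
    open ≡-Reasoning
    a : Fin (suc m)
    a = answer q

  depth-compile : ∀ {B A k} (bit : Q → Fin width → B) (p : Query A k) → depth (compile bit p) ≤ k * width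
  depth-compile bit (return a)         = z≤n
  depth-compile bit (ask {k} q next) =
    depth-readBits width (bit q) _ (k * width) (λ r → depth-compile bit (next (toFin r)))

NephewSol-cong : ∀ {M} {f g f′ g′ : Fin M → Fin M} {w} → (∀ v → f v ≡ f′ v) → (∀ v → g v ≡ g′ v) →
                 NephewSol f g w → NephewSol f′ g′ w
NephewSol-cong {f = f} {g} {f′} {g′} {w} f≗ g≗ =
  Sum.map (λ ne e → ne (trans ffg≡ (trans e (sym (f≗ w))))) (trans (sym fg≡))
  where
  fg≡ : f (g w) ≡ f′ (g′ w)
  fg≡ = trans (f≗ (g w)) (cong f′ (g≗ w))
  ffg≡ : f (f (g w)) ≡ f′ (f′ (g′ w))
  ffg≡ = trans (f≗ (f (g w))) (cong f′ fg≡)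

¬NephewSol : ∀ {M} {f g : Fin M → Fin M} {w} → f (f (g w)) ≡ f w → f (g w) ≢ w → ¬ NephewSol f g w
¬NephewSol same _    (inj₁ differ) = differ same
¬NephewSol _    ≢w   (inj₂ ≡w)     = ≢w ≡w

module EmptyChildToNephew (n : ℕ) where

  V : Set
  V = Fin (suc n)

  root : V
  root = fzero

  -- Deciders on raw values, so that the query algorithms below compute the Nephew instance
  -- and the solution map definitionally.
  isolated? : (p Fp Lp Rp : V) → Dec (Fp ≡ p × Lp ≡ p × Rp ≡ p)
  isolated? p Fp Lp Rp = (Fp ≟ᶠ p) ×-dec (Lp ≟ᶠ p) ×-dec (Rp ≟ᶠ p)

  siblingOf : (w Lp Rp : V) → V
  siblingOf w Lp Rp = if does (Lp ≟ᶠ w) then Rp else Lp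

  emptyChild? : (c Lc Rc FLc FRc L₁ R₁ F₁ : V) →
                Dec ((FLc ≢ c ⊎ FRc ≢ c ⊎ (Lc ≡ Rc × Rc ≢ c))
                     ⊎ (c ≡ root × (L₁ ≡ root ⊎ R₁ ≡ root ⊎ F₁ ≢ root)))
  emptyChild? c Lc Rc FLc FRc L₁ R₁ F₁ =
    (¬? (FLc ≟ᶠ c) ⊎-dec ¬? (FRc ≟ᶠ c) ⊎-dec ((Lc ≟ᶠ Rc) ×-dec ¬? (Rc ≟ᶠ c)))
    ⊎-dec ((c ≟ᶠ root) ×-dec ((L₁ ≟ᶠ root) ⊎-dec (R₁ ≟ᶠ root) ⊎-dec ¬? (F₁ ≟ᶠ root)))

  module NephewInstance (I : ECInput n) where
    open ECInput I

    Isolated : V → Set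
    Isolated p = F p ≡ p × L p ≡ p × R p ≡ p

    Isolated? : (p : V) → Dec (Isolated p)
    Isolated? p = isolated? p (F p) (L p) (R p)

    sibling : V → V
    sibling w = siblingOf w (L (F w)) (R (F w))

    f : V → V
    f u = if does (Isolated? (F u)) then root else F u

    g : V → V
    g u = if does (Isolated? (F u)) then L (L root) else L (sibling u)

    EmptyChild? : (c : V) → Dec (ECSol I c)
    EmptyChild? c = emptyChild? c (L c) (R c) (F (L c)) (F (R c)) (L root) (R root) (F root)

    back : V → V
    back w = if does (EmptyChild? root)        then root
        else if does (EmptyChild? (L root))    then L root
        else if does (EmptyChild? (F w))       then F w
        else if does (EmptyChild? (sibling w)) then sibling w
        else root

    Regular : V → Set
    Regular c = F (L c) ≡ c × F (R c) ≡ c × (L c ≡ R c → R c ≡ c)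

    regular : ∀ {c} → ¬ ECSol I c → Regular c
    regular ¬sol =
      decidable-stable (_ ≟ᶠ _) (λ ne → ¬sol (inj₁ (inj₁ ne))) ,
      decidable-stable (_ ≟ᶠ _) (λ ne → ¬sol (inj₁ (inj₂ (inj₁ ne)))) ,
      λ L≡R → decidable-stable (_ ≟ᶠ _) (λ ne → ¬sol (inj₁ (inj₂ (inj₂ (L≡R , ne)))))

    L-root≢root : ¬ ECSol I root → L root ≢ root
    L-root≢root ¬sol L₁≡1 = ¬sol (inj₂ (refl , inj₁ L₁≡1))

    f-isolated : ∀ {u} → Isolated (F u) → f u ≡ root
    f-isolated {u} = if-does-yes (Isolated? (F u))

    f-nonIsolated : ∀ {u} → ¬ Isolated (F u) → f u ≡ F u
    f-nonIsolated {u} = if-does-no (Isolated? (F u))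

    g-isolated : ∀ {u} → Isolated (F u) → g u ≡ L (L root)
    g-isolated {u} = if-does-yes (Isolated? (F u))

    g-nonIsolated : ∀ {u} → ¬ Isolated (F u) → g u ≡ L (sibling u)
    g-nonIsolated {u} = if-does-no (Isolated? (F u))

    f-child : ∀ {c} → Regular c → ¬ Isolated c → f (L c) ≡ c
    f-child (FLc≡c , _) ¬iso = trans (f-nonIsolated (¬iso ∘ subst Isolated FLc≡c)) FLc≡c

    sibling-cases : ∀ w → (L (F w) ≡ w × sibling w ≡ R (F w)) ⊎ (L (F w) ≢ w × sibling w ≡ L (F w))
    sibling-cases w with L (F w) ≟ᶠ w
    ... | yes L≡w = inj₁ (L≡w , refl)
    ... | no  L≢w = inj₂ (L≢w , refl)

    F-sibling : ∀ {w} → Regular (F w) → F (sibling w) ≡ F w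
    F-sibling {w} (FL≡ , FR≡ , _) with sibling-cases w
    ... | inj₁ (_ , s≡R) = trans (cong F s≡R) FR≡
    ... | inj₂ (_ , s≡L) = trans (cong F s≡L) FL≡

    -- If the sibling were w itself then L p = R p = w for p = F w, and regularity forces w = p.
    sibling≢ : ∀ {w} → Regular (F w) → ¬ Isolated (F w) → sibling w ≢ w
    sibling≢ {w} (_ , _ , L≡R⇒R≡p) ¬iso s≡w with sibling-cases w
    ... | inj₂ (L≢w , s≡L) = L≢w (trans (sym s≡L) s≡w)
    ... | inj₁ (L≡w , s≡R) = ¬iso (cong F (sym w≡p) , trans L≡w w≡p , R≡p)
      where
      R≡w : R (F w) ≡ w
      R≡w = trans (sym s≡R) s≡w
      R≡p : R (F w) ≡ F w
      R≡p = L≡R⇒R≡p (trans L≡w (sym R≡w))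
      w≡p : w ≡ F w
      w≡p = trans (sym R≡w) R≡p

    noNephew-isolated : L root ≢ root → Regular root → Regular (L root) →
                        ∀ {w} → Isolated (F w) → ¬ NephewSol f g w
    noNephew-isolated L₁≢1 reg₁ regL₁ {w} iso = ¬NephewSol {f = f} {g = g} fffgw≡fw fgw≢w
      where
      ¬iso₁ : ¬ Isolated root
      ¬iso₁ (_ , L₁≡1 , _) = L₁≢1 L₁≡1
      ¬isoL₁ : ¬ Isolated (L root)
      ¬isoL₁ (FL₁≡L₁ , _) = L₁≢1 (trans (sym FL₁≡L₁) (proj₁ reg₁))
      fgw≡L₁ : f (g w) ≡ L root
      fgw≡L₁ = trans (cong f (g-isolated iso)) (f-child regL₁ ¬isoL₁)
      fffgw≡fw : f (f (g w)) ≡ f w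
      fffgw≡fw = trans (cong f fgw≡L₁) (trans (f-child reg₁ ¬iso₁) (sym (f-isolated iso)))
      fgw≢w : f (g w) ≢ w
      fgw≢w fgw≡w = ¬iso₁ (subst Isolated (trans (cong F (trans (sym fgw≡w) fgw≡L₁)) (proj₁ reg₁)) iso)

    noNephew-nonIsolated : ∀ {w} → Regular (F w) → Regular (sibling w) → ¬ Isolated (F w) →
                           ¬ NephewSol f g w
    noNephew-nonIsolated {w} regp regs ¬iso = ¬NephewSol {f = f} {g = g} fffgw≡fw fgw≢w
      where
      Fs≡p : F (sibling w) ≡ F w
      Fs≡p = F-sibling regp
      ¬isos : ¬ Isolated (sibling w)
      ¬isos isos = ¬iso (subst Isolated (trans (sym (proj₁ isos)) Fs≡p) isos)
      fgw≡s : f (g w) ≡ sibling w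
      fgw≡s = trans (cong f (g-nonIsolated ¬iso)) (f-child regs ¬isos)
      fffgw≡fw : f (f (g w)) ≡ f w
      fffgw≡fw = begin
        f (f (g w))   ≡⟨ cong f fgw≡s ⟩
        f (sibling w) ≡⟨ f-nonIsolated (¬iso ∘ subst Isolated Fs≡p) ⟩
        F (sibling w) ≡⟨ Fs≡p ⟩
        F w           ≡⟨ sym (f-nonIsolated ¬iso) ⟩
        f w           ∎
        where open ≡-Reasoning
      fgw≢w : f (g w) ≢ w
      fgw≢w = sibling≢ regp ¬iso ∘ trans (sym fgw≡s)

    back-correct : ∀ w → NephewSol f g w → ECSol I (back w)
    back-correct w sol =
      if-does-elim (ECSol I) (EmptyChild? root)        id λ ¬sol₁ →
      if-does-elim (ECSol I) (EmptyChild? (L root))    id λ ¬solL₁ →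
      if-does-elim (ECSol I) (EmptyChild? (F w))       id λ ¬solp →
      if-does-elim (ECSol I) (EmptyChild? (sibling w)) id λ ¬sols →
      ⊥-elim (noNephew (Isolated? (F w)) ¬sol₁ ¬solL₁ ¬solp ¬sols)
      where
      noNephew : Dec (Isolated (F w)) → ¬ ECSol I root → ¬ ECSol I (L root) →
                 ¬ ECSol I (F w) → ¬ ECSol I (sibling w) → ⊥
      noNephew (yes iso) ¬sol₁ ¬solL₁ _ _ =
        noNephew-isolated (L-root≢root ¬sol₁) (regular ¬sol₁) (regular ¬solL₁) iso sol
      noNephew (no ¬iso) _ _ ¬solp ¬sols = noNephew-nonIsolated (regular ¬solp) (regular ¬sols) ¬iso sol

  open Queries (Fin 3 × V) n

  askF askL askR : ∀ {A k} → V → (V → Query A k) → Query A (suc k)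
  askF v = ask (fzero , v)
  askL v = ask (fsuc fzero , v)
  askR v = ask (fsuc (fsuc fzero) , v)

  fQuery : V → Query V 22
  fQuery u = askF u λ p → askF p λ Fp → askL p λ Lp → askR p λ Rp →
             return (if does (isolated? p Fp Lp Rp) then root else p)

  gQuery : V → Query V 22
  gQuery u = askF u λ p → askF p λ Fp → askL p λ Lp → askR p λ Rp →
             askL root λ L₁ → askL L₁ λ LL₁ → askL (siblingOf u Lp Rp) λ Ls →
             return (if does (isolated? p Fp Lp Rp) then LL₁ else Ls)

  askEmptyChild : ∀ {A k} (L₁ R₁ F₁ c : V) → (Bool → Query A k) → Query A (4 + k)
  askEmptyChild L₁ R₁ F₁ c next =
    askL c λ Lc → askR c λ Rc → askF Lc λ FLc → askF Rc λ FRc →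
    next (does (emptyChild? c Lc Rc FLc FRc L₁ R₁ F₁))

  backQuery : V → Query V 22
  backQuery w =
    askL root λ L₁ → askR root λ R₁ → askF root λ F₁ →
    askF w λ p → askL p λ Lp → askR p λ Rp →
    askEmptyChild L₁ R₁ F₁ root λ at1 →
    askEmptyChild L₁ R₁ F₁ L₁ λ atL₁ →
    askEmptyChild L₁ R₁ F₁ p λ atp →
    askEmptyChild L₁ R₁ F₁ (siblingOf w Lp Rp) λ ats →
    return (if at1 then root else if atL₁ then L₁ else if atp then p
            else if ats then siblingOf w Lp Rp else root)

  answer : ECInput n → Fin 3 × V → V
  answer I (fzero , v)               = ECInput.F I v
  answer I (fsuc fzero , v)          = ECInput.L I v
  answer I (fsuc (fsuc _) , v)       = ECInput.R I v

  bitAddress : Fin 3 × V → Fin width → ECQuery n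
  bitAddress (q , v) i = q , v , i

  ecBits-answer : ∀ I qv i → ecBits I (bitAddress qv i) ≡ testBit (toℕ (answer I qv)) (toℕ i)
  ecBits-answer I (fzero , v)         i = refl
  ecBits-answer I (fsuc fzero , v)    i = refl
  ecBits-answer I (fsuc (fsuc _) , v) i = refl

  eval-compile-ecBits : ∀ {A k} (I : ECInput n) (p : Query A k) →
                   eval (compile bitAddress p) (ecBits I) ≡ run p (answer I)
  eval-compile-ecBits I = eval-compile bitAddress (answer I) (ecBits I) (ecBits-answer I)

  reduction : DTReduction n (22 * width) n
  reduction = record
    { fTree    = compile bitAddress ∘ fQuery
    ; gTree    = compile bitAddress ∘ gQuery
    ; solTree  = compile bitAddress ∘ backQuery
    ; fDepth   = depth-compile bitAddress ∘ fQuery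
    ; gDepth   = depth-compile bitAddress ∘ gQuery
    ; solDepth = depth-compile bitAddress ∘ backQuery
    ; correct  = λ I w sol →
        subst (ECSol I) (sym (eval-compile-ecBits I (backQuery w)))
          (NephewInstance.back-correct I w
            (NephewSol-cong (eval-compile-ecBits I ∘ fQuery) (eval-compile-ecBits I ∘ gQuery) sol))
    }

theorem1p7 : EmptyChild≤dtNephew
theorem1p7 = 23 , 1 , λ n → n , 22 * bitLen (suc n) , size n , EmptyChildToNephew.reduction n
  where
  size : ∀ n → bitLen (suc n) + 22 * bitLen (suc n) ≤ 23 * suc (bitLen (suc n)) ^ 1
  size n = *-monoʳ-≤ 23 (≤-trans (n≤1+n b) (≤-reflexive (sym (*-identityʳ (suc b)))))
    where
    b : ℕ
    b = bitLen (suc n)
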